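{- Let $P$ be an extremal program with $n$ clauses, where $2\leq n\leq 4$. Then, for some atoms $a$, $b$, $c$ and $d$: (1) if $n=2$, $\overline{P}= CP[\{a,b\}]$; (2) if $n=3$, $\overline{P}= CP[\{a,b,c\}]$; (3) if $n=4$, $\overline{P}= CP[\{a,b,c,d\}]$, or $\overline{P}= CP[\{a,b\}] \cup CP[\{c,d\}]$.
   Context: We consider finite propositional normal logic programs, with clauses of the form $a \leftarrow b_1,\ldots,b_m,\mathbf{not}(c_1),\ldots,\mathbf{not}(c_k)$, under the stable model semantics. For a program $P$, $s(P)$ denotes the number of stable models of $P$. ${\cal LP}_n$ is the class of normal logic programs with at most $n$ clauses, and $s(n)=\max\{s(P)\colon P\in{\cal LP}_n\}$. A program with $n$ clauses is called extremal if it has $s(n)$ stable models (the maximum possible among programs in ${\cal LP}_n$). An atom $q$ occurring in $P$ is called redundant if $q$ is not the head of any clause of $P$; $\overline{P}$ denotes the program obtained from $P$ by removing all negated occurrences of redundant atoms. For a set of atoms $A=\{a_1,\ldots,a_k\}$, let $c(a_i)$ be the clause $a_i \leftarrow \mathbf{not}(a_1),\ldots,\mathbf{not}(a_{i-1}),\mathbf{not}(a_{i+1}),\ldots,\mathbf{not}(a_k)$, and the canonical program $CP[A]$ is the program consisting of exactly the $k$ clauses $c(a_1),\ldots,c(a_k)$; its stable models are exactly $\{a_1\},\ldots,\{a_k\}$. -}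

module Defs where

open import Data.Nat using (ℕ; _≤_; _≟_)
open import Data.List using (List; []; _∷_; map; filter; length; _++_)
open import Data.List.Membership.Propositional using (_∈_; _∉_)
open import Data.List.Membership.DecPropositional _≟_ using (_∈?_)
open import Data.List.Relation.Unary.Any using (Any; any?)
open import Data.List.Relation.Unary.All using (All)
open import Relation.Nullary using (yes; no)
open import Data.List.Relation.Unary.AllPairs using (AllPairs)
open import Data.Product using (Σ; _×_; _,_)
open import Relation.Binary.PropositionalEquality using (_≡_)
open import Relation.Nullary using (¬_)
open import Relation.Nullary.Decidable using (¬?)

Atom : Set
Atom = ℕ

-- A normal clause  head ← pos₁,…,posₘ, not(neg₁),…,not(negₖ).
-- Bodies are read as sets of atoms (order and repetition irrelevant).
record Clause : Set where
  constructor _⟵_,not_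
  field
    head : Atom
    pos  : List Atom
    neg  : List Atom
open Clause public

Program : Set
Program = List Clause

_⊆_ : List Atom → List Atom → Set
A ⊆ B = ∀ {x} → x ∈ A → x ∈ B

_≋_ : List Atom → List Atom → Set
A ≋ B = (A ⊆ B) × (B ⊆ A)

record Horn : Set where
  constructor _⟸_
  field
    hhead : Atom
    hbody : List Atom
open Horn public

reduct : List Atom → Program → List Horn
reduct M [] = []
reduct M (cl ∷ P) with any? (_∈? M) (neg cl)
... | yes _ = reduct M P
... | no  _ = (head cl ⟸ pos cl) ∷ reduct M P

IsModel : List Atom → List Horn → Set
IsModel N H = ∀ {h} → h ∈ H → hbody h ⊆ N → hhead h ∈ N

IsLeastModel : List Atom → List Horn → Set
IsLeastModel M H = IsModel M H × (∀ (N : List Atom) → IsModel N H → M ⊆ N)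

IsStable : Program → List Atom → Set
IsStable P M = IsLeastModel M (reduct M P)

-- P has at least k stable models: there are k pairwise distinct (as sets)
-- stable models of P.  Since every program has finitely many stable models,
-- s(P) is the largest such k.
AtLeastStable : Program → ℕ → Set
AtLeastStable P k =
  Σ (List (List Atom)) λ Ms →
    (length Ms ≡ k) × All (IsStable P) Ms
      × AllPairs (λ M N → ¬ (M ≋ N)) Ms

-- P is extremal with n clauses: P has n clauses and s(P) = s(n), i.e.
-- s(Q) ≤ s(P) for every program Q with at most n clauses.
Extremal : ℕ → Program → Set
Extremal n P =
  (length P ≡ n) ×
  (∀ (Q : Program) → length Q ≤ n → ∀ k → AtLeastStable Q k → AtLeastStable P k)

heads : Program → List Atom
heads P = map head P

-- q is redundant in P iff q occurs in P but is the head of no clause.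
-- P̄ removes all negated occurrences of redundant atoms, i.e. keeps only
-- negated atoms that are heads of some clause of P.
bar : Program → Program
bar P = map (λ cl → head cl ⟵ pos cl ,not filter (_∈? heads P) (neg cl)) P

canonClause : List Atom → Atom → Clause
canonClause A a = a ⟵ [] ,not filter (λ b → ¬? (b ≟ a)) A

CP : List Atom → Program
CP A = map (canonClause A) A

_≈c_ : Clause → Clause → Set
c ≈c d = (head c ≡ head d) × (pos c ≋ pos d) × (neg c ≋ neg d)

_≈P_ : Program → Program → Set
P ≈P Q = (∀ {c} → c ∈ P → Any (c ≈c_) Q) × (∀ {d} → d ∈ Q → Any (d ≈c_) P)

Distinct : List Atom → Set
Distinct = AllPairs (λ x y → ¬ (x ≡ y))

{-# OPTIONS --safe #-}
module Submission where

-- An extremal program P with n clauses has n stable models, as CP[{0,…,n−1}] has, and they are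
-- pairwise incomparable sets of heads. Were two heads equal, they would be n incomparable subsets of
-- an (n − 1)-element set, impossible for n ≤ 4 (Sperner). So the heads are distinct, and a stable
-- model is recorded by its profile, the set of indices of the clauses whose heads it contains. As
-- stable models are supported and closed, the profiles constrain every clause. A computation over all
-- antichains of n subsets of {0,…,n−1} shows that these constraints are either contradictory or force
-- every clause of P̄ to be the canonical clause of its block in one of a few partitions of the heads.

open import Defs
open import Data.Empty using (⊥-elim)
open import Data.Fin using (Fin; punchIn; punchOut; cast)
open import Data.Fin.Patterns using (0F; 1F; 2F; 3F)
open import Data.Fin.Properties using (all?; any?; punchIn-punchOut; cast-involutive)
  renaming (_≟_ to _≟ᶠ_)
open import Data.Fin.Subset using (Subset; inside; outside)
  renaming (_∈_ to _∈ₛ_; _∉_ to _∉ₛ_; _⊆_ to _⊆ₛ_)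
open import Data.Fin.Subset.Properties using () renaming (_∈?_ to _∈ₛ?_; _⊆?_ to _⊆ₛ?_)
open import Data.Nat using (ℕ; zero; suc; _≤_; _≟_)
open import Data.Nat.Properties using (≤-reflexive)
open import Data.List
  using (List; []; _∷_; [_]; _++_; map; filter; length; lookup; concat; concatMap; upTo)
open import Data.List.Properties using (length-map; length-upTo; ++-identityʳ)
open import Data.List.Membership.Propositional using (_∈_; _∉_; find; lose)
open import Data.List.Membership.Propositional.Properties
  using ( ∈-map⁺; ∈-map⁻; ∈-filter⁺; ∈-filter⁻; ∈-++⁺ˡ; ∈-++⁺ʳ
        ; ∈-concat⁺′; ∈-concat⁻′; ∈-concatMap⁺; ∈-lookup)
open import Data.List.Membership.DecPropositional _≟_ using (_∈?_)
open import Data.List.Relation.Unary.All as All using (All; []; _∷_)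
import Data.List.Relation.Unary.All.Properties as All
open import Data.List.Relation.Unary.Any as Any using (Any; here; there)
import Data.List.Relation.Unary.Any.Properties as Any
open import Data.List.Relation.Unary.AllPairs as AllPairs using (AllPairs; []; _∷_)
import Data.List.Relation.Unary.AllPairs.Properties as AllPairs
open import Data.List.Relation.Unary.Unique.Propositional using (Unique)
import Data.List.Relation.Unary.Unique.Propositional.Properties as Unique
open import Data.Product as Product using (∃-syntax; _×_; _,_; proj₁; proj₂; swap)
open import Data.Sum using (_⊎_; inj₁; inj₂)
open import Data.Vec using ([]; _∷_; tabulate)
open import Data.Vec.Properties using (lookup∘tabulate; lookup⇒[]=; []=⇒lookup)
open import Function using (_∘_; case_of_)
open import Function.Definitions using (Injective)
open import Relation.Nullary using (¬_; Dec; yes; no; does)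
open import Relation.Nullary.Decidable
  using (¬?; _×-dec_; _⊎-dec_; _→-dec_; decidable-stable; dec-true; from-yes)
open import Relation.Binary.PropositionalEquality using (_≡_; _≢_; refl; sym; trans; cong; subst)

private
  variable
    k : ℕ
    a x : Atom
    A M N : List Atom
    P : Program
    cl : Clause

Unblocked : List Atom → Clause → Set
Unblocked M cl = ¬ Any (_∈ M) (neg cl)

reduct⁺ : cl ∈ P → Unblocked M cl → (head cl ⟸ pos cl) ∈ reduct M P
reduct⁺ {P = c ∷ _} {M} (here refl) ub with Any.any? (_∈? M) (neg c)
... | yes blocked = ⊥-elim (ub blocked)
... | no _        = here refl
reduct⁺ {P = c ∷ _} {M} (there cl∈) ub with Any.any? (_∈? M) (neg c)
... | yes _ = reduct⁺ cl∈ ub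
... | no _  = there (reduct⁺ cl∈ ub)

reduct⁻ : ∀ P {r} → r ∈ reduct M P → ∃[ cl ] cl ∈ P × Unblocked M cl × r ≡ (head cl ⟸ pos cl)
reduct⁻ {M} (c ∷ P) r∈ with Any.any? (_∈? M) (neg c) | r∈
... | yes _ | r∈′       = Product.map₂ (Product.map₁ there) (reduct⁻ P r∈′)
... | no ub | here refl = c , here refl , ub , refl
... | no _  | there r∈′ = Product.map₂ (Product.map₁ there) (reduct⁻ P r∈′)

stable-closed : IsStable P M → cl ∈ P → Unblocked M cl → pos cl ⊆ M → head cl ∈ M
stable-closed stable cl∈ ub = proj₁ stable (reduct⁺ cl∈ ub)

stable⊆heads : IsStable P M → M ⊆ heads P
stable⊆heads {P} {M} stable = proj₂ stable (heads P) heads-model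
  where
  heads-model : IsModel (heads P) (reduct M P)
  heads-model r∈ _ with reduct⁻ P r∈
  ... | cl , cl∈ , _ , refl = ∈-map⁺ head cl∈

stable-minimal : ∀ P → IsStable P M → IsStable P N → N ⊆ M → M ⊆ N
stable-minimal {M} {N} P stableM stableN N⊆M = proj₂ stableM N N-model
  where
  N-model : IsModel N (reduct M P)
  N-model r∈ body⊆N with reduct⁻ P r∈
  ... | cl , cl∈ , ub , refl = stable-closed stableN cl∈ (ub ∘ Any.map N⊆M) body⊆N

stable-incomparable : ∀ P → IsStable P M → IsStable P N → ¬ M ≋ N → ¬ M ⊆ N
stable-incomparable P stableM stableN M≉N M⊆N = M≉N (M⊆N , stable-minimal P stableN stableM M⊆N)

infixl 30 _─_

_─_ : List Atom → Atom → List Atom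
M ─ a = filter (λ x → ¬? (x ≟ a)) M

∈-─⁺ : x ∈ M → x ≢ a → x ∈ M ─ a
∈-─⁺ = ∈-filter⁺ _

∈-─⁻ : ∀ M → x ∈ M ─ a → x ∈ M × x ≢ a
∈-─⁻ M = ∈-filter⁻ _ {xs = M}

-- Otherwise M ─ head cl would be a model of the reduct, contradicting minimality.
stable-supported : (∀ {c} → c ∈ P → head c ≡ head cl → c ≡ cl) → IsStable P M → cl ∈ P →
                   head cl ∈ M → Unblocked M cl × pos cl ⊆ M ─ head cl
stable-supported {P} {cl} {M} unique stable cl∈ hd∈M
  with ¬? (Any.any? (_∈? M) (neg cl)) ×-dec All.all? (_∈? M ─ head cl) (pos cl)
... | yes (ub , pos⊆) = ub , All.lookup pos⊆
... | no unsupported  = ⊥-elim (proj₂ (∈-─⁻ M (proj₂ stable (M ─ head cl) shrunk-model hd∈M)) refl)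
  where
  shrunk-model : IsModel (M ─ head cl) (reduct M P)
  shrunk-model r∈ body⊆ with reduct⁻ P r∈
  ... | c , c∈ , ub , refl = ∈-─⁺ (stable-closed stable c∈ ub (proj₁ ∘ ∈-─⁻ M ∘ body⊆)) other-head
    where
    other-head : head c ≢ head cl
    other-head same with unique c∈ same
    ... | refl = unsupported (ub , All.tabulate body⊆)

CP-stable : a ∈ A → IsStable (CP A) [ a ]
CP-stable {a} {A} a∈A = model , least
  where
  model : IsModel [ a ] (reduct [ a ] (CP A))
  model r∈ _ with reduct⁻ (CP A) r∈
  ... | cl , cl∈ , ub , refl with ∈-map⁻ (canonClause A) cl∈
  ... | b , _ , refl =
    here (decidable-stable (b ≟ a) λ b≢a → ub (lose (∈-filter⁺ _ a∈A (b≢a ∘ sym)) (here refl)))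

  unblocked : Unblocked [ a ] (canonClause A a)
  unblocked blocked with find blocked
  ... | _ , x∈ , here refl = proj₂ (∈-filter⁻ _ {xs = A} x∈) refl

  least : ∀ N → IsModel N (reduct [ a ] (CP A)) → [ a ] ⊆ N
  least N modelN (here refl) = modelN (reduct⁺ (∈-map⁺ (canonClause A) a∈A) unblocked) (λ ())

singletons-≉ : ∀ {a b} → a ≢ b → ¬ [ a ] ≋ [ b ]
singletons-≉ a≢b (a⊆b , _) with a⊆b (here refl)
... | here a≡b = a≢b a≡b

CP-atLeastStable : Distinct A → AtLeastStable (CP A) (length A)
CP-atLeastStable {A} distinct =
  map [_] A , length-map [_] A , All.map⁺ (All.tabulate CP-stable) ,
  AllPairs.map⁺ (AllPairs.map singletons-≉ distinct)

extremal-atLeastStable : ∀ {n} P → Extremal n P → AtLeastStable P n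
extremal-atLeastStable {n} _ (_ , maximal) =
  maximal (CP (upTo n)) (≤-reflexive (trans (length-map _ (upTo n)) (length-upTo n))) n
    (subst (AtLeastStable (CP (upTo n))) (length-upTo n) (CP-atLeastStable (Unique.upTo⁺ n)))

Covers : (Fin k → Atom) → List Atom → Set
Covers g M = ∀ {x} → x ∈ M → ∃[ j ] x ≡ g j

profile : (Fin k → Atom) → List Atom → Subset k
profile g M = tabulate (λ j → does (g j ∈? M))

module _ {g : Fin k → Atom} {j : Fin k} where

  ∈-profile⁺ : g j ∈ M → j ∈ₛ profile g M
  ∈-profile⁺ {M} gj∈M = lookup⇒[]= j _ (trans (lookup∘tabulate _ j) (dec-true (g j ∈? M) gj∈M))

  ∈-profile⁻ : j ∈ₛ profile g M → g j ∈ M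
  ∈-profile⁻ {M} j∈ with g j ∈? M | trans (sym (lookup∘tabulate _ j)) ([]=⇒lookup j∈)
  ... | yes gj∈M | _ = gj∈M

profile-⊆⁻ : {g : Fin k → Atom} → Covers g M → profile g M ⊆ₛ profile g N → M ⊆ N
profile-⊆⁻ covers sub x∈ with covers x∈
... | j , refl = ∈-profile⁻ (sub (∈-profile⁺ x∈))

Incomparable : Subset k → Subset k → Set
Incomparable p q = ¬ p ⊆ₛ q × ¬ q ⊆ₛ p

incomparable? : (p q : Subset k) → Dec (Incomparable p q)
incomparable? p q = ¬? (p ⊆ₛ? q) ×-dec ¬? (q ⊆ₛ? p)

profiles-incomparable : {g : Fin k → Atom} {Ms : List (List Atom)} →
                        (∀ {M} → IsStable P M → Covers g M) →
                        All (IsStable P) Ms → AllPairs (λ M N → ¬ M ≋ N) Ms →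
                        AllPairs Incomparable (map (profile g) Ms)
profiles-incomparable covers [] [] = []
profiles-incomparable {P = P} {g = g} {M ∷ _} covers (stableM ∷ stables) (M≉Ms ∷ Ms!) =
  All.map⁺ (All.zipWith incomparable (stables , M≉Ms)) ∷ profiles-incomparable {P = P} covers stables Ms!
  where
  incomparable : ∀ {N} → IsStable P N × ¬ M ≋ N → Incomparable (profile g M) (profile g N)
  incomparable (stableN , M≉N) =
    (λ sub → stable-incomparable P stableM stableN M≉N (profile-⊆⁻ (covers stableM) sub)) ,
    (λ sub → stable-incomparable P stableN stableM (M≉N ∘ swap) (profile-⊆⁻ (covers stableN) sub))

subsets : ∀ k → List (Subset k)
subsets zero    = [ [] ]
subsets (suc k) = map (outside ∷_) (subsets k) ++ map (inside ∷_) (subsets k)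

∈-subsets : (p : Subset k) → p ∈ subsets k
∈-subsets []            = here refl
∈-subsets (outside ∷ p) = ∈-++⁺ˡ (∈-map⁺ (outside ∷_) (∈-subsets p))
∈-subsets (inside ∷ p)  = ∈-++⁺ʳ _ (∈-map⁺ (inside ∷_) (∈-subsets p))

extensions : List (Subset k) → List (List (Subset k))
extensions {k} ps = map (_∷ ps) (filter (λ p → All.all? (incomparable? p) ps) (subsets k))

antichains : ∀ k → ℕ → List (List (Subset k))
antichains k zero    = [ [] ]
antichains k (suc m) = concatMap extensions (antichains k m)

∈-antichains : {ps : List (Subset k)} → AllPairs Incomparable ps → ps ∈ antichains k (length ps)
∈-antichains []                          = here refl
∈-antichains {ps = p ∷ ps} (p⋈ps ∷ ps!) =
  ∈-concatMap⁺ extensions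
    (lose (∈-antichains ps!) (∈-map⁺ (_∷ ps) (∈-filter⁺ _ (∈-subsets p) p⋈ps)))

record Enumeration (P : Program) (k : ℕ) : Set where
  field
    clause     : Fin k → Clause
    clause∈    : ∀ i → clause i ∈ P
    enumerates : ∀ {c} → c ∈ P → ∃[ i ] c ≡ clause i

  h : Fin k → Atom
  h = head ∘ clause

  heads-covered : Covers h (heads P)
  heads-covered x∈ with ∈-map⁻ head x∈
  ... | c , c∈ , refl with enumerates c∈
  ... | i , refl = i , refl

  stable-covered : IsStable P M → Covers h M
  stable-covered stable = heads-covered ∘ stable⊆heads stable

lookup-enumeration : ∀ P → length P ≡ k → Enumeration P k
lookup-enumeration P |P| = record
  { clause     = lookup P ∘ cast (sym |P|)
  ; clause∈    = λ i → ∈-lookup (cast (sym |P|) i)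
  ; enumerates = λ c∈ → cast |P| (Any.index c∈) ,
      trans (Any.lookup-index c∈) (cong (lookup P) (sym (cast-involutive (sym |P|) |P| _)))
  }

punchIn-covers : ∀ {B : Set} (f : Fin (suc k) → B) {i j} → i ≢ j → f i ≡ f j →
                 ∀ l → ∃[ l′ ] f l ≡ f (punchIn j l′)
punchIn-covers f {i} {j} i≢j fi≡fj l with l ≟ᶠ j
... | yes refl = punchOut (i≢j ∘ sym) , trans (sym fi≡fj) (cong f (sym (punchIn-punchOut _)))
... | no l≢j   = punchOut (l≢j ∘ sym) , cong f (sym (punchIn-punchOut _))

-- Two clauses with one head would leave only k labels for suc k incomparable stable models.
heads-injective : (E : Enumeration P (suc k)) → antichains k (suc k) ≡ [] → AtLeastStable P (suc k) →
                  Injective _≡_ _≡_ (Enumeration.h E)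
heads-injective {P} {k} E none (Ms , |Ms| , stableMs , Ms!) {i} {j} hi≡hj =
  decidable-stable (i ≟ᶠ j) λ i≢j → case subst (collapsed-profiles ∈_) none (collapsed∈ i≢j) of λ ()
  where
  open Enumeration E

  collapsed-profiles : List (Subset k)
  collapsed-profiles = map (profile (h ∘ punchIn j)) Ms

  collapsed∈ : i ≢ j → collapsed-profiles ∈ antichains k (suc k)
  collapsed∈ i≢j = subst (λ m → collapsed-profiles ∈ antichains k m) (trans (length-map _ Ms) |Ms|)
                     (∈-antichains (profiles-incomparable {P = P} covers stableMs Ms!))
    where
    covers : IsStable P M → Covers (h ∘ punchIn j) M
    covers stable x∈ with stable-covered stable x∈
    ... | l , refl = punchIn-covers h i≢j hi≡hj l

-- In a family of stable-model profiles, the positive body of clause i lies in every model containing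
-- i and its negative body avoids every head co-occurring with i. Forces i m: these constraints alone
-- make clause i fire in m. Pinned b i: they make clause i the canonical clause of i in the block b.
module _ (ms : List (Subset k)) where

  Forces : Fin k → Subset k → Set
  Forces i m = (∀ j → j ≢ i → All (λ m′ → i ∈ₛ m′ → j ∈ₛ m′) ms → j ∈ₛ m)
             × (∀ l → l ∈ₛ m → Any (λ m′ → i ∈ₛ m′ × l ∈ₛ m′) ms)

  Refuted : Set
  Refuted = ∃[ i ] Any (i ∈ₛ_) ms × Any (λ m → i ∉ₛ m × Forces i m) ms

  Rival : List (Fin k) → Fin k → Fin k → Set
  Rival b i j = j ∈ b × j ≢ i

  Pinned : List (Fin k) → Fin k → Set
  Pinned b i = Any (i ∈ₛ_) ms
             × (∀ j → j ≢ i → Any (λ m → i ∈ₛ m × j ∉ₛ m) ms)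
             × (∀ j → ¬ Rival b i j → Any (λ m → i ∈ₛ m × j ∈ₛ m) ms)
             × (∀ j → Rival b i j →
                  Any (λ m → i ∉ₛ m × j ∈ₛ m × (∀ l → Rival b i l → l ∈ₛ m → l ≡ j)) ms)

  Canonical : List (List (Fin k)) → Set
  Canonical bs = All (λ b → All (Pinned b) b) bs

Partition : List (List (Fin k)) → Set
Partition bs = Unique (concat bs) × (∀ i → i ∈ concat bs)

Classified : List (List (List (Fin k))) → List (Subset k) → Set
Classified bss ms = Refuted ms ⊎ Any (λ bs → Partition bs × Canonical ms bs) bss

module _ (ms : List (Subset k)) where

  forces? : ∀ i m → Dec (Forces ms i m)
  forces? i m =
          all? (λ j → ¬? (j ≟ᶠ i) →-dec All.all? (λ m′ → i ∈ₛ? m′ →-dec j ∈ₛ? m′) ms →-dec j ∈ₛ? m)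
    ×-dec all? (λ l → l ∈ₛ? m →-dec Any.any? (λ m′ → i ∈ₛ? m′ ×-dec l ∈ₛ? m′) ms)

  refuted? : Dec (Refuted ms)
  refuted? = any? λ i → Any.any? (i ∈ₛ?_) ms ×-dec Any.any? (λ m → ¬? (i ∈ₛ? m) ×-dec forces? i m) ms

  rival? : ∀ b i j → Dec (Rival ms b i j)
  rival? b i j = Any.any? (j ≟ᶠ_) b ×-dec ¬? (j ≟ᶠ i)

  pinned? : ∀ b i → Dec (Pinned ms b i)
  pinned? b i = Any.any? (i ∈ₛ?_) ms
    ×-dec all? (λ j → ¬? (j ≟ᶠ i) →-dec Any.any? (λ m → i ∈ₛ? m ×-dec ¬? (j ∈ₛ? m)) ms)
    ×-dec all? (λ j → ¬? (rival? b i j) →-dec Any.any? (λ m → i ∈ₛ? m ×-dec j ∈ₛ? m) ms)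
    ×-dec all? (λ j → rival? b i j →-dec Any.any? (λ m → ¬? (i ∈ₛ? m) ×-dec j ∈ₛ? m
                 ×-dec all? (λ l → rival? b i l →-dec l ∈ₛ? m →-dec l ≟ᶠ j)) ms)

partition? : (bs : List (List (Fin k))) → Dec (Partition bs)
partition? bs = AllPairs.allPairs? (λ i j → ¬? (i ≟ᶠ j)) (concat bs)
          ×-dec all? (λ i → Any.any? (i ≟ᶠ_) (concat bs))

classified? : (bss : List (List (List (Fin k)))) (ms : List (Subset k)) → Dec (Classified bss ms)
classified? bss ms =
  refuted? ms ⊎-dec Any.any? (λ bs → partition? bs ×-dec All.all? (λ b → All.all? (pinned? ms b) b) bs) bss

-- Definitionally, bar P = map (restrict P) P.
restrict : Program → Clause → Clause
restrict P cl = head cl ⟵ pos cl ,not filter (_∈? heads P) (neg cl)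

≈c-sym : ∀ {c d} → c ≈c d → d ≈c c
≈c-sym (h≡ , (p⊆ , p⊇) , (n⊆ , n⊇)) = sym h≡ , (p⊇ , p⊆) , (n⊇ , n⊆)

blocksProgram : (Fin k → Atom) → List (List (Fin k)) → Program
blocksProgram h = concatMap (λ b → CP (map h b))

module Profiles (E : Enumeration P k) (injective : Injective _≡_ _≡_ (Enumeration.h E))
                {Ms : List (List Atom)} (stables : All (IsStable P) Ms) where
  open Enumeration E

  ms : List (Subset k)
  ms = map (profile h) Ms

  witness : ∀ {R : Subset k → Set} → Any R ms → ∃[ M ] IsStable P M × R (profile h M)
  witness r with All.lookupAny stables (Any.map⁻ r)
  ... | stable , rM = _ , stable , rM

  everywhere : ∀ {R : Subset k → Set} → (∀ {M} → IsStable P M → R (profile h M)) → All R ms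
  everywhere f = All.map⁺ (All.map f stables)

  unique-head : ∀ {c i} → c ∈ P → head c ≡ h i → c ≡ clause i
  unique-head c∈ same with enumerates c∈
  ... | _ , refl = cong clause (injective same)

  supported : ∀ {i} → IsStable P M → i ∈ₛ profile h M →
              Unblocked M (clause i) × pos (clause i) ⊆ M × h i ∉ pos (clause i)
  supported {M} {i} stable i∈ with stable-supported unique-head stable (clause∈ i) (∈-profile⁻ i∈)
  ... | ub , pos⊆ = ub , proj₁ ∘ ∈-─⁻ M ∘ pos⊆ , λ hi∈ → proj₂ (∈-─⁻ M (pos⊆ hi∈)) refl

  closed : ∀ {i} → IsStable P M → Unblocked M (clause i) → pos (clause i) ⊆ M → i ∈ₛ profile h M
  closed {i = i} stable ub pos⊆M = ∈-profile⁺ (stable-closed stable (clause∈ i) ub pos⊆M)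

  positive-atom : ∀ {i y} → Any (i ∈ₛ_) ms → y ∈ pos (clause i) →
                  ∃[ j ] y ≡ h j × j ≢ i × All (λ m → i ∈ₛ m → j ∈ₛ m) ms
  positive-atom occurs y∈ with witness occurs
  ... | M , stable , i∈M with supported stable i∈M
  ... | _ , pos⊆M , hi∉pos with stable-covered stable (pos⊆M y∈)
  ... | j , refl = j , refl , (λ { refl → hi∉pos y∈ }) ,
                   everywhere (λ stable′ i∈ → ∈-profile⁺ (proj₁ (proj₂ (supported stable′ i∈)) y∈))

  negative-atom : ∀ {i j} → Any (λ m → i ∈ₛ m × j ∈ₛ m) ms → h j ∉ neg (clause i)
  negative-atom both hj∈neg with witness both
  ... | M , stable , i∈M , j∈M = proj₁ (supported stable i∈M) (lose hj∈neg (∈-profile⁻ j∈M))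

  not-refuted : ¬ Refuted ms
  not-refuted (i , occurs , forced) with witness forced
  ... | M , stable , i∉M , pos-forced , neg-free = i∉M (closed stable unblocked pos⊆M)
    where
    unblocked : Unblocked M (clause i)
    unblocked blocked with find blocked
    ... | x , x∈neg , x∈M with stable-covered stable x∈M
    ... | l , refl = negative-atom (neg-free l (∈-profile⁺ x∈M)) x∈neg

    pos⊆M : pos (clause i) ⊆ M
    pos⊆M y∈ with positive-atom occurs y∈
    ... | j , refl , j≢i , always = ∈-profile⁻ (pos-forced j j≢i always)

  pinned-clause : ∀ {b i} → Pinned ms b i → restrict P (clause i) ≈c canonClause (map h b) (h i)
  pinned-clause {b} {i} (occurs , separated , co-occurs , witnessed) =
    refl , (no-pos , λ ()) , (neg⊆rivals , rivals⊆neg)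
    where
    no-pos : pos (clause i) ⊆ []
    no-pos y∈ with positive-atom occurs y∈
    ... | j , refl , j≢i , always with All.lookupAny always (separated j j≢i)
    ... | i⇒j , i∈ , j∉ = ⊥-elim (j∉ (i⇒j i∈))

    negated-rival : ∀ {j} → h j ∈ neg (clause i) → Rival ms b i j
    negated-rival {j} hj∈neg = decidable-stable (rival? ms b i j) λ not-rival →
      negative-atom (co-occurs j not-rival) hj∈neg

    -- In the witnessing model clause i must be blocked, and h j is the only head there that can block it.
    rival-negated : ∀ {j} → Rival ms b i j → h j ∈ neg (clause i)
    rival-negated {j} rival with witness (witnessed j rival)
    ... | M , stable , i∉M , j∈M , sole with Any.any? (_∈? M) (neg (clause i))
    ... | no ub = ⊥-elim (i∉M (closed stable ub (λ y∈ → case no-pos y∈ of λ ())))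
    ... | yes blocked with find blocked
    ... | x , x∈neg , x∈M with stable-covered stable x∈M
    ... | l , refl with sole l (negated-rival x∈neg) (∈-profile⁺ x∈M)
    ... | refl = x∈neg

    neg⊆rivals : filter (_∈? heads P) (neg (clause i)) ⊆ filter (λ x → ¬? (x ≟ h i)) (map h b)
    neg⊆rivals x∈ with ∈-filter⁻ _ {xs = neg (clause i)} x∈
    ... | x∈neg , x∈heads with heads-covered x∈heads
    ... | j , refl with negated-rival x∈neg
    ... | j∈b , j≢i = ∈-filter⁺ _ (∈-map⁺ h j∈b) (j≢i ∘ injective)

    rivals⊆neg : filter (λ x → ¬? (x ≟ h i)) (map h b) ⊆ filter (_∈? heads P) (neg (clause i))
    rivals⊆neg x∈ with ∈-filter⁻ _ {xs = map h b} x∈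
    ... | x∈hb , x≢hi with ∈-map⁻ h x∈hb
    ... | j , j∈b , refl =
      ∈-filter⁺ _ (rival-negated (j∈b , λ { refl → x≢hi refl })) (∈-map⁺ head (clause∈ j))

  canonical-bar : ∀ {bs} → Partition bs → Canonical ms bs → bar P ≈P blocksProgram h bs
  canonical-bar {bs} (_ , covering) pinned = to , from
    where
    pinned-at : ∀ {b j} → b ∈ bs → j ∈ b → restrict P (clause j) ≈c canonClause (map h b) (h j)
    pinned-at b∈ j∈ = pinned-clause (All.lookup (All.lookup pinned b∈) j∈)

    to : ∀ {c} → c ∈ bar P → Any (c ≈c_) (blocksProgram h bs)
    to c∈ with ∈-map⁻ (restrict P) c∈
    ... | cl , cl∈ , refl with enumerates cl∈
    ... | i , refl with ∈-concat⁻′ bs (covering i)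
    ... | b , i∈b , b∈bs =
      lose (∈-concat⁺′ (∈-map⁺ (canonClause (map h b)) (∈-map⁺ h i∈b)) (∈-map⁺ (λ b → CP (map h b)) b∈bs))
        (pinned-at b∈bs i∈b)

    from : ∀ {d} → d ∈ blocksProgram h bs → Any (d ≈c_) (bar P)
    from d∈ with ∈-concat⁻′ (map (λ b → CP (map h b)) bs) d∈
    ... | _ , d∈CP , CP∈ with ∈-map⁻ (λ b → CP (map h b)) CP∈
    ... | b , b∈bs , refl with ∈-map⁻ (canonClause (map h b)) d∈CP
    ... | _ , x∈hb , refl with ∈-map⁻ h x∈hb
    ... | j , j∈b , refl = lose (∈-map⁺ (restrict P) (clause∈ j)) (≈c-sym (pinned-at b∈bs j∈b))

bar≈blocksProgram : ∀ P → length P ≡ suc k → AtLeastStable P (suc k) → antichains k (suc k) ≡ [] →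
                    (bss : List (List (List (Fin (suc k))))) →
                    All (Classified bss) (antichains (suc k) (suc k)) →
                    ∃[ h ] Any (λ bs → Distinct (map h (concat bs)) × bar P ≈P blocksProgram h bs) bss
bar≈blocksProgram {k} P |P| stables@(Ms , |Ms| , stableMs , Ms!) none bss classified = h , blocks
  where
  E = lookup-enumeration P |P|
  open Enumeration E using (h; stable-covered)
  injective = heads-injective E none stables
  open Profiles E injective stableMs

  profiles∈ : ms ∈ antichains (suc k) (suc k)
  profiles∈ = subst (λ m → ms ∈ antichains (suc k) m) (trans (length-map _ Ms) |Ms|)
                (∈-antichains (profiles-incomparable {P = P} stable-covered stableMs Ms!))

  blocks : Any (λ bs → Distinct (map h (concat bs)) × bar P ≈P blocksProgram h bs) bss
  blocks with All.lookup classified profiles∈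
  ... | inj₁ refuted   = ⊥-elim (not-refuted refuted)
  ... | inj₂ canonical = Any.map (λ (partition , pinned) →
                           Unique.map⁺ injective (proj₁ partition) , canonical-bar partition pinned) canonical

partitions₂ : List (List (List (Fin 2)))
partitions₂ = [ [ 0F ∷ 1F ∷ [] ] ]

partitions₃ : List (List (List (Fin 3)))
partitions₃ = [ [ 0F ∷ 1F ∷ 2F ∷ [] ] ]

partitions₄ : List (List (List (Fin 4)))
partitions₄ = [ 0F ∷ 1F ∷ 2F ∷ 3F ∷ [] ]
            ∷ ((0F ∷ 1F ∷ []) ∷ [ 2F ∷ 3F ∷ [] ])
            ∷ ((0F ∷ 2F ∷ []) ∷ [ 1F ∷ 3F ∷ [] ])
            ∷ ((0F ∷ 3F ∷ []) ∷ [ 1F ∷ 2F ∷ [] ])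
            ∷ []

abstract
  classified₂ : All (Classified partitions₂) (antichains 2 2)
  classified₂ = from-yes (All.all? (classified? partitions₂) (antichains 2 2))

  classified₃ : All (Classified partitions₃) (antichains 3 3)
  classified₃ = from-yes (All.all? (classified? partitions₃) (antichains 3 3))

  classified₄ : All (Classified partitions₄) (antichains 4 4)
  classified₄ = from-yes (All.all? (classified? partitions₄) (antichains 4 4))

extremal₂-canonical : ∀ P → Extremal 2 P →
                      ∃[ a ] ∃[ b ] Distinct (a ∷ b ∷ []) × bar P ≈P CP (a ∷ b ∷ [])
extremal₂-canonical P extremal@(|P| , _)
  with bar≈blocksProgram P |P| (extremal-atLeastStable P extremal) refl partitions₂ classified₂
... | _ , here (distinct , P≈) = _ , _ , distinct , subst (bar P ≈P_) (++-identityʳ _) P≈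

extremal₃-canonical : ∀ P → Extremal 3 P →
                      ∃[ a ] ∃[ b ] ∃[ c ] Distinct (a ∷ b ∷ c ∷ [])
                        × bar P ≈P CP (a ∷ b ∷ c ∷ [])
extremal₃-canonical P extremal@(|P| , _)
  with bar≈blocksProgram P |P| (extremal-atLeastStable P extremal) refl partitions₃ classified₃
... | _ , here (distinct , P≈) = _ , _ , _ , distinct , subst (bar P ≈P_) (++-identityʳ _) P≈

-- Stated with atoms rather than programs R ++ S: CP of an explicit list normalises to a list of
-- clauses, from which R and S could not be inferred.
≈P-CP-++-[] : ∀ {Q a b c d} → Q ≈P (CP (a ∷ b ∷ []) ++ CP (c ∷ d ∷ []) ++ []) →
              Q ≈P (CP (a ∷ b ∷ []) ++ CP (c ∷ d ∷ []))
≈P-CP-++-[] {Q} {a} {b} = subst (Q ≈P_) (cong (CP (a ∷ b ∷ []) ++_) (++-identityʳ _))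

extremal₄-canonical : ∀ P → Extremal 4 P →
                      ∃[ a ] ∃[ b ] ∃[ c ] ∃[ d ] Distinct (a ∷ b ∷ c ∷ d ∷ [])
                        × (bar P ≈P CP (a ∷ b ∷ c ∷ d ∷ [])
                           ⊎ bar P ≈P (CP (a ∷ b ∷ []) ++ CP (c ∷ d ∷ [])))
extremal₄-canonical P extremal@(|P| , _)
  with bar≈blocksProgram P |P| (extremal-atLeastStable P extremal) refl partitions₄ classified₄
... | _ , here (distinct , P≈) =
  _ , _ , _ , _ , distinct , inj₁ (subst (bar P ≈P_) (++-identityʳ _) P≈)
... | _ , there (here (distinct , P≈))                 = _ , _ , _ , _ , distinct , inj₂ (≈P-CP-++-[] P≈)
... | _ , there (there (here (distinct , P≈)))         = _ , _ , _ , _ , distinct , inj₂ (≈P-CP-++-[] P≈)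
... | _ , there (there (there (here (distinct , P≈)))) = _ , _ , _ , _ , distinct , inj₂ (≈P-CP-++-[] P≈)

lemma8 : (n : ℕ) (P : Program) → 2 ≤ n → n ≤ 4 → Extremal n P →
    ((n ≡ 2) → ∃[ a ] ∃[ b ] Distinct (a ∷ b ∷ []) × (bar P ≈P CP (a ∷ b ∷ [])))
    × ((n ≡ 3) → ∃[ a ] ∃[ b ] ∃[ c ] Distinct (a ∷ b ∷ c ∷ [])
         × (bar P ≈P CP (a ∷ b ∷ c ∷ [])))
    × ((n ≡ 4) → ∃[ a ] ∃[ b ] ∃[ c ] ∃[ d ] Distinct (a ∷ b ∷ c ∷ d ∷ [])
         × ((bar P ≈P CP (a ∷ b ∷ c ∷ d ∷ []))
            ⊎ (bar P ≈P (CP (a ∷ b ∷ []) ++ CP (c ∷ d ∷ [])))))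
lemma8 n P _ _ extremal =
  (λ { refl → extremal₂-canonical P extremal }) ,
  (λ { refl → extremal₃-canonical P extremal }) ,
  (λ { refl → extremal₄-canonical P extremal })
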